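{- If $G$ is a connected $r$-regular graph with $r\ge 2$, of order $n(G)$ and girth $g(G)\ge 6$, then $$\chi_\mu(G)\le\left\lceil\frac{n(G)-r^2+4}{2}\right\rceil.$$
   Context: The girth is the length of a shortest cycle. For a connected graph $G$ and $S\subseteq V(G)$, two vertices $x,y\in S$ are $S$-visible if there is a shortest $x,y$-path $P$ in $G$ with $V(P)\cap S=\{x,y\}$. $S$ is a mutual-visibility set if any two vertices of $S$ are $S$-visible. A mutual-visibility coloring of $G$ is a partition of $V(G)$ into mutual-visibility sets, and the mutual-visibility chromatic number $\chi_\mu(G)$ is the smallest number of classes in such a partition. -}

module Defs where

open import Data.Nat using (ℕ; zero; suc; _+_; _*_; _∸_; _≤_; ⌈_/2⌉)
open import Data.Fin using (Fin; zero; suc; inject₁; fromℕ)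
open import Data.Bool using (Bool; true; false; T; if_then_else_)
open import Data.List using (List; map; allFin)
open import Data.Nat.ListAction using (sum)
open import Data.Product using (Σ; _×_; _,_; ∃)
open import Data.Sum using (_⊎_)
open import Relation.Binary.PropositionalEquality using (_≡_)
open import Function.Definitions using (Injective)

record Graph (n : ℕ) : Set where
  field
    adj    : Fin n → Fin n → Bool
    sym    : ∀ u v → adj u v ≡ adj v u
    irrefl : ∀ v → adj v v ≡ false

module _ {n : ℕ} (G : Graph n) where
  open Graph G

  Adj : Fin n → Fin n → Set
  Adj u v = T (adj u v)

  degree : Fin n → ℕ
  degree v = sum (map (λ u → if adj v u then 1 else 0) (allFin n))

  Regular : ℕ → Set
  Regular r = ∀ v → degree v ≡ r

  record Path (k : ℕ) (x y : Fin n) : Set where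
    field
      vtx   : Fin (suc k) → Fin n
      start : vtx zero ≡ x
      end   : vtx (fromℕ k) ≡ y
      step  : ∀ (i : Fin k) → Adj (vtx (inject₁ i)) (vtx (suc i))
      inj   : Injective _≡_ _≡_ vtx

  Connected : Set
  Connected = ∀ x y → ∃ λ k → Path k x y

  ShortestPath : (k : ℕ) (x y : Fin n) → Path k x y → Set
  ShortestPath k x y P = ∀ j → Path j x y → k ≤ j

  -- A cycle of length (suc m) (with suc m ≥ 3): distinct vertices
  -- c 0, ..., c m, consecutive ones adjacent, and c m adjacent to c 0.
  record Cycle (m : ℕ) : Set where
    field
      long  : 3 ≤ suc m
      vtx   : Fin (suc m) → Fin n
      step  : ∀ (i : Fin m) → Adj (vtx (inject₁ i)) (vtx (suc i))
      close : Adj (vtx (fromℕ m)) (vtx zero)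
      inj   : Injective _≡_ _≡_ vtx

  -- girth g(G) ≥ b : every cycle has length at least b
  -- (vacuous for acyclic graphs, whose girth is ∞)
  GirthAtLeast : ℕ → Set
  GirthAtLeast b = ∀ m → Cycle m → b ≤ suc m

  VSet : Set₁
  VSet = Fin n → Set

  Visible : VSet → Fin n → Fin n → Set
  Visible S x y =
    Σ ℕ λ k → Σ (Path k x y) λ P → ShortestPath k x y P ×
      (∀ i → S (Path.vtx P i) → (Path.vtx P i ≡ x) ⊎ (Path.vtx P i ≡ y))

  MutualVisibilitySet : VSet → Set
  MutualVisibilitySet S = ∀ x y → S x → S y → Visible S x y

  MVColoring : (k : ℕ) → (Fin n → Fin k) → Set
  MVColoring k c = ∀ (j : Fin k) → MutualVisibilitySet (λ v → c v ≡ j)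

  IsMVChromaticNumber : ℕ → Set
  IsMVChromaticNumber k =
    (Σ (Fin n → Fin k) λ c → MVColoring k c) ×
    (∀ k′ → (c : Fin n → Fin k′) → MVColoring k′ c → k ≤ k′)

-- Fix a vertex v and colour its r neighbours 0 and the vertices at distance two 1.
-- As the girth is at least 6 there are no 3-, 4- or 5-cycles, so both classes are
-- independent, two neighbours of v see each other through v, and two vertices at
-- distance two see each other through their (unique) neighbours in N(v), possibly via v:
-- whenever the distance is at least 4, that path of length at most 4 is shortest, and
-- otherwise every inner vertex of a shortest path is adjacent to an end, hence outside
-- the independent class. Since two vertices have at most one common neighbour, the
-- r² − r walks of length two from v that do not return to v end at distinct vertices at
-- distance two; this leaves at most n − r² other vertices, and these are paired off
-- into classes of size at most two, which are trivially mutual-visibility sets.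
-- Altogether 2 + ⌈(n − r²)/2⌉ colours suffice.

module Submission where

open import Defs
open import Data.Nat using (ℕ; zero; suc; _+_; _*_; _∸_; _≤_; _<_; _≤?_; z≤n; s≤s; ⌈_/2⌉; ⌊_/2⌋)
open import Data.Nat.Properties
open import Data.Nat.Induction using (<-rec)
open import Data.Fin using (Fin; zero; suc; inject₁; fromℕ; toℕ; fromℕ<) renaming (_<_ to _<ᶠ_)
import Data.Fin.Properties as Fin
open import Data.Bool using (Bool; true; false; T; if_then_else_)
open import Data.List using (map; allFin; tabulate)
open import Data.List.Properties using (map-tabulate)
open import Data.Vec using (Vec; []; _∷_; lookup)
open import Data.Vec.Relation.Unary.All using ([]; _∷_)
open import Data.Vec.Relation.Unary.AllPairs using ([]; _∷_)
open import Data.Vec.Relation.Unary.Unique.Propositional using (Unique)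
open import Data.Vec.Relation.Unary.Unique.Propositional.Properties using (lookup-injective)
import Data.Nat.ListAction as List
open import Data.Vec.Functional using (Vector; removeAt)
open import Data.Product using (Σ; _×_; _,_; proj₁; proj₂; ∃)
open import Data.Sum using (_⊎_; inj₁; inj₂)
import Data.Sum as ⊎
open import Data.Empty using (⊥; ⊥-elim)
open import Relation.Nullary using (¬_; Dec; yes; no)
open import Relation.Nullary.Decidable using (_×-dec_; ¬?; T?)
open import Relation.Binary.Definitions using (tri<; tri≈; tri>)
open import Relation.Binary.PropositionalEquality
open import Function using (_∘_; id)
open import Algebra.Properties.Semiring.Sum +-*-semiring

sum-mono-≤ : ∀ {n} {f g : Vector ℕ n} → (∀ i → f i ≤ g i) → sum f ≤ sum g
sum-mono-≤ {zero}  _   = z≤n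
sum-mono-≤ {suc n} f≤g = +-mono-≤ (f≤g zero) (sum-mono-≤ (f≤g ∘ suc))

sum-const-1 : ∀ n → ∑[ i < n ] 1 ≡ n
sum-const-1 zero    = refl
sum-const-1 (suc n) = cong suc (sum-const-1 n)

sum-tabulate : ∀ {n} (f : Vector ℕ n) → List.sum (tabulate f) ≡ sum f
sum-tabulate {zero}  f = refl
sum-tabulate {suc n} f = cong (f zero +_) (sum-tabulate (f ∘ suc))

sum-map-allFin : ∀ {n} (f : Vector ℕ n) → List.sum (map f (allFin n)) ≡ sum f
sum-map-allFin {n} f = trans (cong List.sum (map-tabulate id f)) (sum-tabulate f)

sum-≤-except : ∀ {n} (f g : Vector ℕ n) i → (∀ j → j ≢ i → f j ≤ g j) → sum f ≤ f i + sum g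
sum-≤-except {suc _} f g i f≤g = begin
  sum f                      ≡⟨ sum-remove f ⟩
  f i + sum (removeAt f i)   ≤⟨ +-monoʳ-≤ (f i) (sum-mono-≤ (λ j → f≤g _ (Fin.punchInᵢ≢i i j))) ⟩
  f i + sum (removeAt g i)   ≤⟨ +-monoʳ-≤ (f i) (m≤n+m _ (g i)) ⟩
  f i + (g i + sum (removeAt g i)) ≡⟨ cong (f i +_) (sum-remove g) ⟨
  f i + sum g                ∎
  where open ≤-Reasoning

sum-zero : ∀ {n} {f : Vector ℕ n} → (∀ i → f i ≡ 0) → sum f ≡ 0
sum-zero {n} f≡0 = trans (sum-cong-≗ f≡0) (sum-replicate-zero n)

sum-≤-single : ∀ {n} (f : Vector ℕ n) i → (∀ j → j ≢ i → f j ≡ 0) → sum f ≤ f i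
sum-≤-single {n} f i f≡0 = begin
  sum f                  ≤⟨ sum-≤-except f (λ _ → 0) i (λ j j≢i → ≤-reflexive (f≡0 j j≢i)) ⟩
  f i + ∑[ j < n ] 0     ≡⟨ cong (f i +_) (sum-zero {n} (λ _ → refl)) ⟩
  f i + 0                ≡⟨ +-identityʳ (f i) ⟩
  f i                    ∎
  where open ≤-Reasoning

indicator : Bool → ℕ
indicator b = if b then 1 else 0

indicator-≤1 : ∀ b → indicator b ≤ 1
indicator-≤1 true  = ≤-refl
indicator-≤1 false = z≤n

indicator-*-≤ˡ : ∀ a b → indicator a * indicator b ≤ indicator a
indicator-*-≤ˡ true  true  = ≤-refl
indicator-*-≤ˡ true  false = z≤n
indicator-*-≤ˡ false _     = z≤n

indicator-T : ∀ {b} → T b → indicator b ≡ 1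
indicator-T {true} _ = refl

indicator-¬T : ∀ {b} → ¬ T b → indicator b ≡ 0
indicator-¬T {true}  ¬b = ⊥-elim (¬b _)
indicator-¬T {false} _  = refl

indicator-*-≡0 : ∀ a b → (T a → T b → ⊥) → indicator a * indicator b ≡ 0
indicator-*-≡0 true  true  ¬ab = ⊥-elim (¬ab _ _)
indicator-*-≡0 true  false _   = refl
indicator-*-≡0 false _     _   = refl

count : ∀ {n} → (Fin n → Bool) → ℕ
count {n} p = ∑[ i < n ] indicator (p i)

rank : ∀ {n} → (Fin n → Bool) → Fin n → ℕ
rank p zero    = 0
rank p (suc i) = indicator (p zero) + rank (p ∘ suc) i

rank<count : ∀ {n} (p : Fin n → Bool) i → T (p i) → rank p i < count p
rank<count p zero    pi with p zero
... | true = s≤s z≤n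
rank<count p (suc i) pi = +-monoʳ-< (indicator (p zero)) (rank<count (p ∘ suc) i pi)

rank-injective : ∀ {n} (p : Fin n → Bool) {i j} → T (p i) → T (p j) → rank p i ≡ rank p j → i ≡ j
rank-injective p {zero}  {zero}  _  _  _ = refl
rank-injective p {zero}  {suc j} pi _  e with p zero | e
... | true | ()
rank-injective p {suc i} {zero}  _  pj e with p zero | e
... | true | ()
rank-injective p {suc i} {suc j} pi pj e =
  cong suc (rank-injective (p ∘ suc) pi pj (+-cancelˡ-≡ (indicator (p zero)) _ _ e))

⌊/2⌋-fibre-≤2 : ∀ a b c → ⌊ a /2⌋ ≡ ⌊ b /2⌋ → ⌊ a /2⌋ ≡ ⌊ c /2⌋ → a ≡ b ⊎ a ≡ c ⊎ b ≡ c
⌊/2⌋-fibre-≤2 0 0 _ _ _ = inj₁ refl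
⌊/2⌋-fibre-≤2 1 1 _ _ _ = inj₁ refl
⌊/2⌋-fibre-≤2 0 1 0 _ _ = inj₂ (inj₁ refl)
⌊/2⌋-fibre-≤2 0 1 1 _ _ = inj₂ (inj₂ refl)
⌊/2⌋-fibre-≤2 1 0 0 _ _ = inj₂ (inj₂ refl)
⌊/2⌋-fibre-≤2 1 0 1 _ _ = inj₂ (inj₁ refl)
⌊/2⌋-fibre-≤2 (suc (suc a)) (suc (suc b)) (suc (suc c)) e e′ =
  ⊎.map (cong (2 +_)) (⊎.map (cong (2 +_)) (cong (2 +_)))
    (⌊/2⌋-fibre-≤2 a b c (suc-injective e) (suc-injective e′))

Minimal : (ℕ → Set) → ℕ → Set
Minimal P j = P j × (∀ i → P i → j ≤ i)

least-witness : {P : ℕ → Set} → (∀ k → Dec (P k)) → ∀ k → P k → ∃ (Minimal P)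
least-witness {P} P? = <-rec _ search
  where
  search : ∀ k → (∀ {i} → i < k → P i → ∃ (Minimal P)) → P k → ∃ (Minimal P)
  search k smaller pk with Fin.any? (λ (i : Fin k) → P? (toℕ i))
  ... | yes (i , pi) = smaller (Fin.toℕ<n i) pi
  ... | no ¬smaller  = k , pk , λ i pi → ≮⇒≥ λ i<k →
        ¬smaller (fromℕ< i<k , subst P (sym (Fin.toℕ-fromℕ< i<k)) pi)

module _ {n : ℕ} (G : Graph n) where

  open Graph G using (adj)

  Walk : ℕ → Fin n → Fin n → Set
  Walk zero    x y = x ≡ y
  Walk (suc k) x y = ∃ λ z → Adj G x z × Walk k z y

  walk? : ∀ k x y → Dec (Walk k x y)
  walk? zero    x y = x Fin.≟ y
  walk? (suc k) x y = Fin.any? λ z → T? (adj x z) ×-dec walk? k z y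

  vertex : ∀ {k x y} → Walk k x y → Fin (suc k) → Fin n
  vertex {x = x} _           zero    = x
  vertex {suc k} (_ , _ , w) (suc i) = vertex w i

  vertex-last : ∀ {k x y} (w : Walk k x y) → vertex w (fromℕ k) ≡ y
  vertex-last {zero}  x≡y         = x≡y
  vertex-last {suc k} (_ , _ , w) = vertex-last w

  vertex-step : ∀ {k x y} (w : Walk k x y) (i : Fin k) → Adj G (vertex w (inject₁ i)) (vertex w (suc i))
  vertex-step {suc k} (_ , xz , _) zero    = xz
  vertex-step {suc k} (_ , _  , w) (suc i) = vertex-step w i

  suffix : ∀ {k x y} (w : Walk k x y) i → ∃ λ l → l ≤ k × Walk l (vertex w i) y
  suffix {k}     w           zero    = k , ≤-refl , w
  suffix {suc k} (_ , _ , w) (suc i) with suffix w i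
  ... | l , l≤k , w′ = l , m≤n⇒m≤1+n l≤k , w′

  shortcut : ∀ {k x y} (w : Walk k x y) {i j} → i <ᶠ j → vertex w i ≡ vertex w j →
             ∃ λ l → l < k × Walk l x y
  shortcut {suc k} {y = y} (_ , _ , w) {zero} {suc j} _ x≡wj with suffix w j
  ... | l , l≤k , w′ = l , s≤s l≤k , subst (λ z → Walk l z y) (sym x≡wj) w′
  shortcut {suc k} (z , xz , w) {suc i} {suc j} (s≤s i<j) wi≡wj with shortcut w i<j wi≡wj
  ... | l , l<k , w′ = suc l , s≤s l<k , z , xz , w′

  minimal-walk-path : ∀ {k x y} (w : Walk k x y) → (∀ l → Walk l x y → k ≤ l) → Path G k x y
  minimal-walk-path {k} w minimal = record
    { vtx = vertex w ; start = refl ; end = vertex-last w ; step = vertex-step w ; inj = injective }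
    where
    no-shortcut : ∀ {i j} → i <ᶠ j → vertex w i ≢ vertex w j
    no-shortcut i<j wi≡wj with shortcut w i<j wi≡wj
    ... | l , l<k , w′ = <⇒≱ l<k (minimal l w′)
    injective : ∀ {i j} → vertex w i ≡ vertex w j → i ≡ j
    injective {i} {j} wi≡wj with Fin.<-cmp i j
    ... | tri< i<j _ _ = ⊥-elim (no-shortcut i<j wi≡wj)
    ... | tri≈ _ i≡j _ = i≡j
    ... | tri> _ _ j<i = ⊥-elim (no-shortcut j<i (sym wi≡wj))

  path-walk : ∀ {k x y} → Path G k x y → Walk k x y
  path-walk {k} P = subst₂ (Walk k) (Path.start P) (Path.end P) (along k (Path.vtx P) (Path.step P))
    where
    along : ∀ k (f : Fin (suc k) → Fin n) → (∀ i → Adj G (f (inject₁ i)) (f (suc i))) →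
            Walk k (f zero) (f (fromℕ k))
    along zero    f _    = refl
    along (suc k) f step = f (suc zero) , step zero , along k (f ∘ suc) (step ∘ suc)

  shortest-path : Connected G → ∀ x y → ∃ λ k → Σ (Path G k x y) (ShortestPath G k x y)
  shortest-path connected x y with connected x y
  ... | k , P with least-witness (λ l → walk? l x y) k (path-walk P)
  ... | j , w , minimal = j , minimal-walk-path w minimal , λ l Q → minimal l (path-walk Q)

  Adj-sym : ∀ {a b} → Adj G a b → Adj G b a
  Adj-sym {a} {b} = subst T (Graph.sym G a b)

  Adj⇒≢ : ∀ {a b} → Adj G a b → a ≢ b
  Adj⇒≢ {a} ab refl = subst T (Graph.irrefl G a) ab

  Consecutive : ∀ {k} → Vec (Fin n) (suc k) → Set
  Consecutive {k} vs = ∀ (i : Fin k) → Adj G (lookup vs (inject₁ i)) (lookup vs (suc i))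

  pathOf : ∀ {k} (vs : Vec (Fin n) (suc k)) → Unique vs → Consecutive vs →
           Path G k (lookup vs zero) (lookup vs (fromℕ k))
  pathOf vs unique step = record
    { vtx = lookup vs ; start = refl ; end = refl ; step = step
    ; inj = lookup-injective unique _ _ }

  cycleOf : ∀ {m} (vs : Vec (Fin n) (suc m)) → 3 ≤ suc m → Unique vs → Consecutive vs →
            Adj G (lookup vs (fromℕ m)) (lookup vs zero) → Cycle G m
  cycleOf vs long unique step close = record
    { long = long ; vtx = lookup vs ; step = step ; close = close
    ; inj = lookup-injective unique _ _ }

  girth-weaken : ∀ {b c} → b ≤ c → GirthAtLeast G c → GirthAtLeast G b
  girth-weaken b≤c girth m C = ≤-trans b≤c (girth m C)

  no-short-cycle : ∀ {b m} → GirthAtLeast G b → (vs : Vec (Fin n) (suc m)) → 3 ≤ suc m → suc m < b →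
                   Unique vs → Consecutive vs → ¬ Adj G (lookup vs (fromℕ m)) (lookup vs zero)
  no-short-cycle {m = m} girth vs long short unique step close =
    <⇒≱ short (girth m (cycleOf vs long unique step close))

  no-triangle : GirthAtLeast G 4 → ∀ {a b c} → Adj G a b → Adj G b c → ¬ Adj G c a
  no-triangle girth ab bc ca = no-short-cycle girth (_ ∷ _ ∷ _ ∷ []) ≤-refl ≤-refl
    ((Adj⇒≢ ab ∷ Adj⇒≢ (Adj-sym ca) ∷ []) ∷ (Adj⇒≢ bc ∷ []) ∷ [] ∷ [])
    (λ { zero → ab ; (suc zero) → bc }) ca

  no-4-cycle : GirthAtLeast G 5 → ∀ {a b c d} → a ≢ c → b ≢ d →
               Adj G a b → Adj G b c → Adj G c d → ¬ Adj G d a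
  no-4-cycle girth a≢c b≢d ab bc cd da = no-short-cycle girth (_ ∷ _ ∷ _ ∷ _ ∷ []) (n≤1+n 3) ≤-refl
    ((Adj⇒≢ ab ∷ a≢c ∷ Adj⇒≢ (Adj-sym da) ∷ []) ∷ (Adj⇒≢ bc ∷ b≢d ∷ []) ∷ (Adj⇒≢ cd ∷ []) ∷ [] ∷ [])
    (λ { zero → ab ; (suc zero) → bc ; (suc (suc zero)) → cd }) da

  no-5-cycle : GirthAtLeast G 6 → ∀ {a b c d e} → a ≢ c → a ≢ d → b ≢ d → b ≢ e → c ≢ e →
               Adj G a b → Adj G b c → Adj G c d → Adj G d e → ¬ Adj G e a
  no-5-cycle girth a≢c a≢d b≢d b≢e c≢e ab bc cd de ea =
    no-short-cycle girth (_ ∷ _ ∷ _ ∷ _ ∷ _ ∷ []) (m≤m+n 3 2) ≤-refl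
      ((Adj⇒≢ ab ∷ a≢c ∷ a≢d ∷ Adj⇒≢ (Adj-sym ea) ∷ []) ∷ (Adj⇒≢ bc ∷ b≢d ∷ b≢e ∷ []) ∷
       (Adj⇒≢ cd ∷ c≢e ∷ []) ∷ (Adj⇒≢ de ∷ []) ∷ [] ∷ [])
      (λ { zero → ab ; (suc zero) → bc ; (suc (suc zero)) → cd ; (suc (suc (suc zero))) → de }) ea

  CommonNeighbour : Fin n → Fin n → Set
  CommonNeighbour v u = ∃ λ w → Adj G v w × Adj G w u

  AtDistanceTwo : Fin n → Fin n → Set
  AtDistanceTwo v u = u ≢ v × ¬ Adj G v u × CommonNeighbour v u

  Avoids : VSet G → ∀ {k x y} → Path G k x y → Set
  Avoids S {x = x} {y} P = ∀ i → S (Path.vtx P i) → Path.vtx P i ≡ x ⊎ Path.vtx P i ≡ y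

  Independent : VSet G → Set
  Independent S = ∀ {a b} → S a → S b → ¬ Adj G a b

  visible-refl : ∀ S x → Visible G S x x
  visible-refl S x = 0 , pathOf (x ∷ []) ([] ∷ []) (λ ()) , (λ _ _ → z≤n) , λ { zero _ → inj₁ refl }

  first-step : ∀ {k x y} (P : Path G (suc k) x y) → Adj G x (Path.vtx P (suc zero))
  first-step P = subst (λ z → Adj G z _) (Path.start P) (Path.step P zero)

  last-step : ∀ {k x y} (P : Path G (suc k) x y) → Adj G (Path.vtx P (inject₁ (fromℕ k))) y
  last-step {k} P = subst (Adj G _) (Path.end P) (Path.step P (fromℕ k))

  -- every inner vertex of a path of length at most 3 is adjacent to an end
  short-path-avoids : ∀ {S x y} → Independent S → S x → S y → ∀ {k} (P : Path G k x y) → k ≤ 3 → Avoids S P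
  short-path-avoids _ _ _ P _ zero _ = inj₁ (Path.start P)
  short-path-avoids _ _ _ {1} P _ (suc zero) _ = inj₂ (Path.end P)
  short-path-avoids indep sx _ {2} P _ (suc zero) s = ⊥-elim (indep sx s (first-step P))
  short-path-avoids _ _ _ {2} P _ (suc (suc zero)) _ = inj₂ (Path.end P)
  short-path-avoids indep sx _ {3} P _ (suc zero) s = ⊥-elim (indep sx s (first-step P))
  short-path-avoids indep _ sy {3} P _ (suc (suc zero)) s = ⊥-elim (indep s sy (last-step P))
  short-path-avoids _ _ _ {3} P _ (suc (suc (suc zero))) _ = inj₂ (Path.end P)
  short-path-avoids _ _ _ {suc (suc (suc (suc _)))} _ (s≤s (s≤s (s≤s ()))) _ _

  distanceTwo-independent : GirthAtLeast G 6 → ∀ {S} v → (∀ {u} → S u → AtDistanceTwo v u) → Independent S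
  distanceTwo-independent girth v S⊆D₂ {a} {b} sa sb ab with S⊆D₂ sa | S⊆D₂ sb
  ... | a≢v , ¬va , p , vp , pa | b≢v , ¬vb , q , vq , qb with p Fin.≟ q
  ...   | yes refl = no-triangle (girth-weaken (m≤m+n 4 2) girth) pa ab (Adj-sym qb)
  ...   | no p≢q   = no-5-cycle girth (a≢v ∘ sym) (b≢v ∘ sym) p≢b p≢q a≢q vp pa ab (Adj-sym qb) (Adj-sym vq)
    where
    p≢b : p ≢ b
    p≢b refl = ¬vb vp
    a≢q : a ≢ q
    a≢q refl = ¬va vq

  module _ (connected : Connected G) where

    -- either Q is itself shortest, or the shortest paths have length at most 3
    visible-via-short-path : ∀ {S x y} → Independent S → S x → S y →
                             ∀ {l} (Q : Path G l x y) → l ≤ 4 → Avoids S Q → Visible G S x y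
    visible-via-short-path {x = x} {y} indep sx sy {l} Q l≤4 Q-avoids with shortest-path connected x y
    ... | k , P , shortest with k ≤? 3
    ...   | yes k≤3 = k , P , shortest , short-path-avoids indep sx sy P k≤3
    ...   | no  k≰3 = l , Q , (λ j R → ≤-trans l≤4 (≤-trans (≰⇒> k≰3) (shortest j R))) , Q-avoids

    mutualVisibility-≤2 : ∀ {S} → (∀ {a b c} → S a → S b → S c → a ≡ b ⊎ a ≡ c ⊎ b ≡ c) →
                          MutualVisibilitySet G S
    mutualVisibility-≤2 {S} at-most-two x y sx sy with x Fin.≟ y
    ... | yes refl = visible-refl S x
    ... | no  x≢y with shortest-path connected x y
    ...   | k , P , shortest = k , P , shortest , P-avoids
      where
      P-avoids : Avoids S P
      P-avoids i s with at-most-two s sx sy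
      ... | inj₁ e        = inj₁ e
      ... | inj₂ (inj₁ e) = inj₂ e
      ... | inj₂ (inj₂ e) = ⊥-elim (x≢y e)

    neighbourhood-mutualVisibility : GirthAtLeast G 4 → ∀ {S} v → (∀ {u} → S u → Adj G v u) →
                                     MutualVisibilitySet G S
    neighbourhood-mutualVisibility girth {S} v S⊆N x y sx sy with x Fin.≟ y
    ... | yes refl = visible-refl S x
    ... | no  x≢y  = visible-via-short-path indep sx sy path (m≤m+n 2 2) path-avoids
      where
      vx : Adj G v x
      vx = S⊆N sx
      vy : Adj G v y
      vy = S⊆N sy
      indep : Independent S
      indep sa sb ab = no-triangle girth (S⊆N sa) ab (Adj-sym (S⊆N sb))
      path : Path G 2 x y
      path = pathOf (x ∷ v ∷ y ∷ []) ((Adj⇒≢ (Adj-sym vx) ∷ x≢y ∷ []) ∷ (Adj⇒≢ vy ∷ []) ∷ [] ∷ [])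
               λ { zero → Adj-sym vx ; (suc zero) → vy }
      path-avoids : Avoids S path
      path-avoids zero             _  = inj₁ refl
      path-avoids (suc zero)       sv = ⊥-elim (Adj⇒≢ (S⊆N sv) refl)
      path-avoids (suc (suc zero)) _  = inj₂ refl

    distanceTwo-mutualVisibility : GirthAtLeast G 6 → ∀ {S} v → (∀ {u} → S u → AtDistanceTwo v u) →
                                   MutualVisibilitySet G S
    distanceTwo-mutualVisibility girth {S} v S⊆D₂ x y sx sy with x Fin.≟ y | S⊆D₂ sx | S⊆D₂ sy
    ... | yes refl | _ | _ = visible-refl S x
    ... | no x≢y | x≢v , ¬vx , p , vp , px | y≢v , ¬vy , q , vq , qy with p Fin.≟ q
    ...   | yes refl =
      visible-via-short-path (distanceTwo-independent girth v S⊆D₂) sx sy path₂ (m≤m+n 2 2) path₂-avoids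
      where
      path₂ : Path G 2 x y
      path₂ = pathOf (x ∷ p ∷ y ∷ []) ((Adj⇒≢ (Adj-sym px) ∷ x≢y ∷ []) ∷ (Adj⇒≢ qy ∷ []) ∷ [] ∷ [])
                λ { zero → Adj-sym px ; (suc zero) → qy }
      path₂-avoids : Avoids S path₂
      path₂-avoids zero             _  = inj₁ refl
      path₂-avoids (suc zero)       sp = ⊥-elim (proj₁ (proj₂ (S⊆D₂ sp)) vp)
      path₂-avoids (suc (suc zero)) _  = inj₂ refl
    ...   | no p≢q =
      visible-via-short-path (distanceTwo-independent girth v S⊆D₂) sx sy path₄ ≤-refl path₄-avoids
      where
      x≢q : x ≢ q
      x≢q refl = ¬vx vq
      p≢y : p ≢ y
      p≢y refl = ¬vy vp
      path₄ : Path G 4 x y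
      path₄ = pathOf (x ∷ p ∷ v ∷ q ∷ y ∷ [])
        ((Adj⇒≢ (Adj-sym px) ∷ x≢v ∷ x≢q ∷ x≢y ∷ []) ∷ (Adj⇒≢ (Adj-sym vp) ∷ p≢q ∷ p≢y ∷ []) ∷
         (Adj⇒≢ vq ∷ (y≢v ∘ sym) ∷ []) ∷ (Adj⇒≢ qy ∷ []) ∷ [] ∷ [])
        λ { zero → Adj-sym px ; (suc zero) → Adj-sym vp ; (suc (suc zero)) → vq ; (suc (suc (suc zero))) → qy }
      path₄-avoids : Avoids S path₄
      path₄-avoids zero                         _  = inj₁ refl
      path₄-avoids (suc zero)                   sp = ⊥-elim (proj₁ (proj₂ (S⊆D₂ sp)) vp)
      path₄-avoids (suc (suc zero))             sv = ⊥-elim (proj₁ (S⊆D₂ sv) refl)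
      path₄-avoids (suc (suc (suc zero)))       sq = ⊥-elim (proj₁ (proj₂ (S⊆D₂ sq)) vq)
      path₄-avoids (suc (suc (suc (suc zero)))) _  = inj₂ refl

  degree-sum : ∀ {r} → Regular G r → ∀ w → ∑[ u < n ] indicator (adj w u) ≡ r
  degree-sum regular w = trans (sym (sum-map-allFin (indicator ∘ adj w))) (regular w)

  visible-antitone : ∀ {S S′ x y} → (∀ {u} → S′ u → S u) → Visible G S x y → Visible G S′ x y
  visible-antitone S′⊆S (k , P , shortest , P-avoids) = k , P , shortest , λ i s′ → P-avoids i (S′⊆S s′)

  χ≤-colouring : ∀ {χ K} → IsMVChromaticNumber G χ → (c : Fin n → ℕ) → (∀ u → c u < K) →
                 (∀ k → MutualVisibilitySet G (λ u → c u ≡ k)) → χ ≤ K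
  χ≤-colouring {K = K} (_ , minimal) c c<K classes = minimal K c′ c′-proper
    where
    c′ : Fin n → Fin K
    c′ u = fromℕ< (c<K u)
    c′≡⇒c≡ : ∀ {j u} → c′ u ≡ j → c u ≡ toℕ j
    c′≡⇒c≡ {u = u} refl = sym (Fin.toℕ-fromℕ< (c<K u))
    c′-proper : MVColoring G K c′
    c′-proper j x y cx cy = visible-antitone {S = λ u → c u ≡ toℕ j} c′≡⇒c≡
      (classes (toℕ j) x y (c′≡⇒c≡ cx) (c′≡⇒c≡ cy))

  module Zones (v : Fin n) where

    data Zone (u : Fin n) : Set where
      neighbour : Adj G v u → Zone u
      second    : AtDistanceTwo v u → Zone u
      -- v itself is remote
      remote    : ¬ Adj G v u → ¬ AtDistanceTwo v u → Zone u

    atDistanceTwo? : ∀ u → Dec (AtDistanceTwo v u)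
    atDistanceTwo? u = ¬? (u Fin.≟ v) ×-dec ¬? (T? (adj v u)) ×-dec
                       Fin.any? (λ w → T? (adj v w) ×-dec T? (adj w u))

    zone : ∀ u → Zone u
    zone u with T? (adj v u) | atDistanceTwo? u
    ... | yes vu | _       = neighbour vu
    ... | no ¬vu | yes d₂  = second d₂
    ... | no ¬vu | no ¬d₂  = remote ¬vu ¬d₂

    isSecond isRemote : ∀ {u} → Zone u → Bool
    isSecond (second _) = true
    isSecond _          = false
    isRemote (remote _ _) = true
    isRemote _            = false

    secondVertex : Fin n → Bool
    secondVertex u = isSecond (zone u)

    remoteVertex : Fin n → Bool
    remoteVertex u = isRemote (zone u)

    zone-partition : ∀ u → indicator (adj v u) + indicator (secondVertex u) + indicator (remoteVertex u) ≡ 1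
    zone-partition u with zone u
    ... | neighbour vu       = cong (λ k → k + 0 + 0) (indicator-T vu)
    ... | second (_ , ¬vu , _) = cong (λ k → k + 1 + 0) (indicator-¬T ¬vu)
    ... | remote ¬vu _       = cong (λ k → k + 0 + 1) (indicator-¬T ¬vu)

    walks₂ : Fin n → ℕ
    walks₂ u = ∑[ w < n ] (indicator (adj v w) * indicator (adj w u))

    walks₂-≤-second : GirthAtLeast G 5 → ∀ u → u ≢ v → walks₂ u ≤ indicator (secondVertex u)
    walks₂-≤-second girth u u≢v with zone u
    ... | neighbour vu = ≤-reflexive (sum-zero {n} λ w →
          indicator-*-≡0 _ _ λ vw wu → no-triangle (girth-weaken (n≤1+n 4) girth) vw wu (Adj-sym vu))
    ... | remote ¬vu ¬d₂ = ≤-reflexive (sum-zero {n} λ w →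
          indicator-*-≡0 _ _ λ vw wu → ¬d₂ (u≢v , ¬vu , w , vw , wu))
    ... | second (_ , _ , w₀ , vw₀ , w₀u) = begin
          walks₂ u                                     ≤⟨ sum-≤-single _ w₀ unique ⟩
          indicator (adj v w₀) * indicator (adj w₀ u)  ≤⟨ indicator-*-≤ˡ _ _ ⟩
          indicator (adj v w₀)                         ≤⟨ indicator-≤1 _ ⟩
          1                                            ∎
      where
      open ≤-Reasoning
      unique : ∀ w → w ≢ w₀ → indicator (adj v w) * indicator (adj w u) ≡ 0
      unique w w≢w₀ = indicator-*-≡0 _ _ λ vw wu →
        no-4-cycle girth (u≢v ∘ sym) w≢w₀ vw wu (Adj-sym w₀u) (Adj-sym vw₀)

    module _ {r} (regular : Regular G r) where

      sum-walks₂ : sum walks₂ ≡ r * r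
      sum-walks₂ = begin
        ∑[ u < n ] ∑[ w < n ] (a w * b w u)   ≡⟨ ∑-comm (λ u w → a w * b w u) ⟩
        ∑[ w < n ] ∑[ u < n ] (a w * b w u)   ≡⟨ sum-cong-≗ (λ w → *-distribˡ-sum (a w) (b w)) ⟨
        ∑[ w < n ] (a w * ∑[ u < n ] b w u)   ≡⟨ sum-cong-≗ (λ w → cong (a w *_) (degree-sum regular w)) ⟩
        ∑[ w < n ] (a w * r)                  ≡⟨ *-distribʳ-sum r a ⟨
        (∑[ w < n ] a w) * r                  ≡⟨ cong (_* r) (degree-sum regular v) ⟩
        r * r                                 ∎
        where
        open ≡-Reasoning
        a : Fin n → ℕ
        a w = indicator (adj v w)
        b : Fin n → Fin n → ℕ
        b w u = indicator (adj w u)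

      walks₂-centre : walks₂ v ≤ r
      walks₂-centre = ≤-trans (sum-mono-≤ (λ w → indicator-*-≤ˡ (adj v w) _))
                              (≤-reflexive (degree-sum regular v))

      order-partition : n ≡ r + count secondVertex + count remoteVertex
      order-partition = begin
        n                               ≡⟨ sum-const-1 n ⟨
        ∑[ u < n ] 1                    ≡⟨ sum-cong-≗ zone-partition ⟨
        ∑[ u < n ] (a u + s u + t u)    ≡⟨ ∑-distrib-+ (λ u → a u + s u) t ⟩
        ∑[ u < n ] (a u + s u) + sum t  ≡⟨ cong (_+ sum t) (∑-distrib-+ a s) ⟩
        sum a + sum s + sum t           ≡⟨ cong (λ k → k + sum s + sum t) (degree-sum regular v) ⟩
        r + sum s + sum t               ∎
        where
        open ≡-Reasoning
        a s t : Fin n → ℕ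
        a u = indicator (adj v u)
        s u = indicator (secondVertex u)
        t u = indicator (remoteVertex u)

      remote-count : GirthAtLeast G 5 → count remoteVertex + r * r ≤ n
      remote-count girth = begin
        count remoteVertex + r * r                  ≡⟨ cong (count remoteVertex +_) sum-walks₂ ⟨
        count remoteVertex + sum walks₂             ≤⟨ +-monoʳ-≤ (count remoteVertex) walks₂-bound ⟩
        count remoteVertex + (r + count secondVertex) ≡⟨ +-comm (count remoteVertex) _ ⟩
        r + count secondVertex + count remoteVertex ≡⟨ order-partition ⟨
        n                                           ∎
        where
        open ≤-Reasoning
        walks₂-bound : sum walks₂ ≤ r + count secondVertex
        walks₂-bound = ≤-trans (sum-≤-except walks₂ _ v (walks₂-≤-second girth))
                               (+-monoˡ-≤ (count secondVertex) walks₂-centre)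

    colour : Fin n → ℕ
    colour u with zone u
    ... | neighbour _ = 0
    ... | second _    = 1
    ... | remote _ _  = 2 + ⌊ rank remoteVertex u /2⌋

    colour-bound : ∀ u → colour u < 2 + ⌈ count remoteVertex /2⌉
    colour-bound u with zone u in eq
    ... | neighbour _ = s≤s z≤n
    ... | second _    = s≤s (s≤s z≤n)
    ... | remote _ _  =
      s≤s (s≤s (⌈n/2⌉-mono (rank<count remoteVertex u (subst (T ∘ isRemote) (sym eq) _))))

    colour≡0 : ∀ {u} → colour u ≡ 0 → Adj G v u
    colour≡0 {u} c≡0 with zone u
    ... | neighbour vu = vu

    colour≡1 : ∀ {u} → colour u ≡ 1 → AtDistanceTwo v u
    colour≡1 {u} c≡1 with zone u
    ... | second d₂ = d₂

    colour≡2+ : ∀ {u k} → colour u ≡ 2 + k → T (remoteVertex u) × ⌊ rank remoteVertex u /2⌋ ≡ k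
    colour≡2+ {u} c≡2+k with zone u
    ... | remote _ _ = _ , suc-injective (suc-injective c≡2+k)

    colourClass-mutualVisibility : Connected G → GirthAtLeast G 6 →
                                   ∀ k → MutualVisibilitySet G (λ u → colour u ≡ k)
    colourClass-mutualVisibility connected girth 0 =
      neighbourhood-mutualVisibility connected (girth-weaken (m≤m+n 4 2) girth) v colour≡0
    colourClass-mutualVisibility connected girth 1 =
      distanceTwo-mutualVisibility connected girth v colour≡1
    colourClass-mutualVisibility connected girth (suc (suc k)) =
      mutualVisibility-≤2 connected at-most-two
      where
      at-most-two : ∀ {a b c} → colour a ≡ 2 + k → colour b ≡ 2 + k → colour c ≡ 2 + k →
                    a ≡ b ⊎ a ≡ c ⊎ b ≡ c
      at-most-two ca cb cc with colour≡2+ ca | colour≡2+ cb | colour≡2+ cc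
      ... | ra , ha | rb , hb | rc , hc =
        ⊎.map (rank-injective _ ra rb) (⊎.map (rank-injective _ ra rc) (rank-injective _ rb rc))
          (⌊/2⌋-fibre-≤2 _ _ _ (trans ha (sym hb)) (trans ha (sym hc)))

c+q≤m⇒2+⌈c/2⌉≤⌈m+4∸q/2⌉ : ∀ {c q m} → c + q ≤ m → 2 + ⌈ c /2⌉ ≤ ⌈ (m + 4) ∸ q /2⌉
c+q≤m⇒2+⌈c/2⌉≤⌈m+4∸q/2⌉ {c} {q} {m} c+q≤m = ⌈n/2⌉-mono (m+n≤o⇒m≤o∸n (4 + c) (begin
  4 + c + q     ≡⟨ +-assoc 4 c q ⟩
  4 + (c + q)   ≤⟨ +-monoʳ-≤ 4 c+q≤m ⟩
  4 + m         ≡⟨ +-comm 4 m ⟩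
  m + 4         ∎))
  where open ≤-Reasoning

proposition5p8 : (n r : ℕ) (G : Graph n) → Connected G → Regular G r → 2 ≤ r →
    GirthAtLeast G 6 → (χ : ℕ) → IsMVChromaticNumber G χ →
    χ ≤ ⌈ (n + 4) ∸ (r * r) /2⌉
proposition5p8 zero    r G _ _ _ _ χ (_ , minimal) = ≤-trans (minimal 0 (λ ()) (λ ())) z≤n
proposition5p8 (suc n) r G connected regular _ girth χ χ-is =
  χ≤-colouring G χ-is colour (λ u → <-≤-trans (colour-bound u) colours-available)
    (colourClass-mutualVisibility connected girth)
  where
  open Zones G zero
  colours-available : 2 + ⌈ count remoteVertex /2⌉ ≤ ⌈ (suc n + 4) ∸ (r * r) /2⌉
  colours-available = c+q≤m⇒2+⌈c/2⌉≤⌈m+4∸q/2⌉ (remote-count regular (girth-weaken G (n≤1+n 5) girth))
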